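{- Let $n$ be sufficiently large, let $G$ be the windmill graph $WM_{2^{n-1}}$ and let $H$ be the circulant graph $G(2^n;\pm\{1,2^{n-2}\})$. Then $EC(G,H)=2^{n-2}$.
   Context: The friendship graph $T_m$ ($2m+1$ vertices) consists of $m$ triangles sharing exactly one common vertex (the hub). The windmill graph $WM_m$ (order $2m$) is obtained from $T_m$ by deleting one vertex of degree $2$. The circulant graph $G(N;\pm S)$, for $S\subseteq\{1,\ldots,\lfloor N/2\rfloor\}$, has vertex set $\{0,1,\ldots,N-1\}$ and edge set $\{(i,k): |k-i|\equiv s \pmod N \text{ for some } s\in S\}$ (equivalently $k-i\equiv \pm s \pmod N$). An embedding of $G$ into $H$ (with $|V(G)|=|V(H)|$) is a pair $(f,P_f)$ with $f:V(G)\to V(H)$ injective and $P_f$ assigning to each edge $uv\in E(G)$ a path in $H$ between $f(u)$ and $f(v)$. For $e\in E(H)$, $EC_f(e)=|\{xy\in E(G): e\in P_f(xy)\}|$, and $EC(G,H)=\min_{(f,P_f)}\max_{e\in E(H)}EC_f(e)$. -}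

module Defs where

open import Data.Bool using (Bool; true; false; T; _∧_; _∨_; not; if_then_else_)
open import Data.Nat using (ℕ; zero; suc; _+_; _*_; _∸_; _^_; _≤_; _≡ᵇ_; _<ᵇ_; _/_; _%_; NonZero)
open import Data.Nat.Properties using (m^n≢0)
open import Data.Fin using (Fin; toℕ)
open import Data.List using (List; []; _∷_; map; allFin)
open import Data.Bool.ListAction using (any)
open import Data.Nat.ListAction using (sum)
open import Data.List.Relation.Unary.Unique.Propositional using (Unique)
open import Data.Product using (Σ; ∃; _×_; _,_)
open import Data.Unit using (tt)
open import Relation.Binary.PropositionalEquality using (_≡_)
open import Function.Definitions using (Injective)

Graph : ℕ → Set
Graph N = Fin N → Fin N → Bool

-- Friendship graph T_m on vertices 0,1,…,2m: hub 0, triangles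
-- {0, 2i-1, 2i} for i = 1..m.  Adjacency on natural-number labels.

friendAdj : ℕ → ℕ → Bool
friendAdj a b =
  not (a ≡ᵇ b) ∧
  ((a ≡ᵇ 0) ∨ (b ≡ᵇ 0) ∨ ((suc a / 2) ≡ᵇ (suc b / 2)))

friendship : (m : ℕ) → Graph (suc (2 * m))
friendship m u v = friendAdj (toℕ u) (toℕ v)

-- Windmill graph WM_m (order 2m): T_m with the degree-2 vertex 2m deleted
-- (induced subgraph on the vertices 0,…,2m-1).
windmill : (m : ℕ) → Graph (2 * m)
windmill m u v = friendAdj (toℕ u) (toℕ v)

circulant : (N : ℕ) .{{_ : NonZero N}} → List ℕ → Graph N
circulant N S i k =
  any (λ s → (d ≡ᵇ (s % N)) ∨ (d ≡ᵇ ((N ∸ s) % N))) S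
  where
  d : ℕ
  d = (toℕ k + N ∸ toℕ i) % N

data Walk {N : ℕ} (H : Graph N) : Fin N → Fin N → Set where
  stop : (a : Fin N) → Walk H a a
  step : {a c : Fin N} (b : Fin N) → T (H a b) → Walk H b c → Walk H a c

vertices : {N : ℕ} {H : Graph N} {a c : Fin N} → Walk H a c → List (Fin N)
vertices (stop a)             = a ∷ []
vertices (step {a = a} b _ w) = a ∷ vertices w

IsPath : {N : ℕ} {H : Graph N} {a c : Fin N} → Walk H a c → Set
IsPath w = Unique (vertices w)

sameFin : {N : ℕ} → Fin N → Fin N → Bool
sameFin x y = toℕ x ≡ᵇ toℕ y

usesEdge : {N : ℕ} {H : Graph N} {a c : Fin N} → Walk H a c → Fin N → Fin N → Bool
usesEdge (stop _) x y = false
usesEdge (step {a = a} b _ w) x y =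
  ((sameFin a x ∧ sameFin b y) ∨ (sameFin a y ∧ sameFin b x)) ∨ usesEdge w x y

record Embedding {N M : ℕ} (G : Graph N) (H : Graph M) : Set where
  field
    f      : Fin N → Fin M
    f-inj  : Injective _≡_ _≡_ f
    P      : (u v : Fin N) → T (G u v) → Walk H (f u) (f v)
    P-path : (u v : Fin N) (e : T (G u v)) → IsPath (P u v e)

ifEdge : (b : Bool) → (T b → Bool) → ℕ
ifEdge true  g = if g tt then 1 else 0
ifEdge false g = 0

-- EC_f(e) for e = {x , y}: number of edges uv of G (each counted once,
-- as the ordered pair with u < v) whose path P_f(uv) contains {x , y}.
EC-f : {N M : ℕ} {G : Graph N} {H : Graph M} → Embedding G H → Fin M → Fin M → ℕ
EC-f {N} {G = G} emb x y =
  sum (map (λ u → sum (map (λ v →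
         if toℕ u <ᵇ toℕ v
         then ifEdge (G u v) (λ e → usesEdge (Embedding.P emb u v e) x y)
         else 0) (allFin N))) (allFin N))

ECis : {N M : ℕ} → Graph N → Graph M → ℕ → Set
ECis G H k =
  (Σ (Embedding G H) λ emb → ∀ x y → T (H x y) → EC-f emb x y ≤ k)
  × (∀ (emb : Embedding G H) → Σ _ λ x → Σ _ λ y → T (H x y) × k ≤ EC-f emb x y)

WMn : (n : ℕ) → Graph (2 * 2 ^ (n ∸ 1))
WMn n = windmill (2 ^ (n ∸ 1))

Hn : (n : ℕ) → Graph (2 ^ n)
Hn n = circulant (2 ^ n) {{m^n≢0 2 n}} (1 ∷ 2 ^ (n ∸ 2) ∷ [])

module Submission where

-- Write q = 2^(n-2) = 2p and N = 4q.  G is the windmill on 0 … N - 1 with hub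
-- 0 and blades {2i - 1 , 2i}; H is the circulant graph with steps ±1 and ±q.
--
-- Lower bound: the hub of G is adjacent to all N - 1 other vertices while H is
-- 4-regular, so in any embedding the N - 1 = 4(q - 1) + 3 paths leaving the
-- image of the hub start along only 4 edges, and by pigeonhole one of these
-- carries q paths (hub-congestion, proved for arbitrary graphs).
--
-- Upper bound: embed G identically.  A blade {U , U + 1} is routed along its
-- unit step; the hub edge 0V goes up the cycle (V ≤ q), hops to q and goes up
-- (V ≤ 2q), hops to 3q and goes down (V ≤ 3q), or hops to N - 1 and goes down.
-- The routes through any edge of H end in a window of q consecutive vertices,
-- or of q - 1 vertices plus one blade; blades start at odd numbers, so never at
-- the even q where the window is full.

open import Data.Bool using (Bool; true; false; T; not; _∧_; _∨_; if_then_else_)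
open import Data.Bool.Properties using (T-∨; T-∧; ∨-identityʳ)
open import Data.Nat
open import Data.Nat.Properties
open import Data.Nat.DivMod
open import Data.Nat.ListAction using (sum)
open import Data.Nat.Tactic.RingSolver using (solve-∀)
open import Data.Fin using (Fin; zero; suc; toℕ; fromℕ<; #_)
open import Data.Fin.Properties using (toℕ-injective; toℕ-fromℕ<; toℕ<n) renaming (0≢1+n to zero≢suc)
open import Data.List using (List; []; _∷_; map; tabulate; allFin; _++_)
open import Data.List.Relation.Unary.All as All using (All; []; _∷_)
import Data.List.Relation.Unary.AllPairs as AllPairs
import Data.List.Relation.Unary.AllPairs.Properties as AllPairs
open import Data.List.Relation.Unary.Unique.Propositional using (Unique)
open import Data.Product using (Σ; _×_; _,_; proj₁; proj₂)
open import Data.Sum as Sum using (_⊎_; inj₁; inj₂)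
open import Data.Empty using (⊥; ⊥-elim)
open import Data.Unit using (tt)
open import Relation.Nullary using (¬_; Dec; yes; no)
open import Relation.Binary.Definitions using (Tri; tri<; tri≈; tri>)
open import Relation.Binary.PropositionalEquality hiding (J)
open import Function using (_∘_; id)
open import Function.Bundles using (Equivalence)
open import Defs

-- Finite sums over Fin n.  The double sum defining EC-f is a list sum over
-- allFin, converted into this form by sum-allFin.
ΣF : (n : ℕ) → (Fin n → ℕ) → ℕ
ΣF zero    h = 0
ΣF (suc n) h = h zero + ΣF n (h ∘ suc)

sum-map-tabulate : ∀ {A : Set} n (f : Fin n → A) (g : A → ℕ) →
                   sum (map g (tabulate f)) ≡ ΣF n (g ∘ f)
sum-map-tabulate zero    f g = refl
sum-map-tabulate (suc n) f g = cong (g (f zero) +_) (sum-map-tabulate n (f ∘ suc) g)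

sum-allFin : ∀ n (g : Fin n → ℕ) → sum (map g (allFin n)) ≡ ΣF n g
sum-allFin n = sum-map-tabulate n id

ΣF-cong : ∀ n {f g : Fin n → ℕ} → (∀ i → f i ≡ g i) → ΣF n f ≡ ΣF n g
ΣF-cong zero    eq = refl
ΣF-cong (suc n) eq = cong₂ _+_ (eq zero) (ΣF-cong n (eq ∘ suc))

ΣF-mono : ∀ n {f g : Fin n → ℕ} → (∀ i → f i ≤ g i) → ΣF n f ≤ ΣF n g
ΣF-mono zero    le = z≤n
ΣF-mono (suc n) le = +-mono-≤ (le zero) (ΣF-mono n (le ∘ suc))

ΣF-+ : ∀ n (f g : Fin n → ℕ) → ΣF n (λ i → f i + g i) ≡ ΣF n f + ΣF n g
ΣF-+ zero    f g = refl
ΣF-+ (suc n) f g = begin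
  (f zero + g zero) + ΣF n (λ i → f (suc i) + g (suc i))
    ≡⟨ cong ((f zero + g zero) +_) (ΣF-+ n (f ∘ suc) (g ∘ suc)) ⟩
  (f zero + g zero) + (ΣF n (f ∘ suc) + ΣF n (g ∘ suc))
    ≡⟨ interchange (f zero) (g zero) _ _ ⟩
  (f zero + ΣF n (f ∘ suc)) + (g zero + ΣF n (g ∘ suc)) ∎
  where
  open ≡-Reasoning
  interchange : ∀ a b c d → (a + b) + (c + d) ≡ (a + c) + (b + d)
  interchange = solve-∀

ΣF-*ʳ : ∀ n (f : Fin n → ℕ) c → ΣF n (λ i → f i * c) ≡ ΣF n f * c
ΣF-*ʳ zero    f c = refl
ΣF-*ʳ (suc n) f c = trans (cong (f zero * c +_) (ΣF-*ʳ n (f ∘ suc) c))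
                          (sym (*-distribʳ-+ c (f zero) _))

ΣF-0 : ∀ n → ΣF n (λ _ → 0) ≡ 0
ΣF-0 zero    = refl
ΣF-0 (suc n) = ΣF-0 n

ΣF-term : ∀ n (f : Fin n → ℕ) i → f i ≤ ΣF n f
ΣF-term (suc n) f zero    = m≤m+n _ _
ΣF-term (suc n) f (suc i) = ≤-trans (ΣF-term n (f ∘ suc) i) (m≤n+m _ _)

ΣF-witness : ∀ n (f : Fin n → ℕ) → 1 ≤ ΣF n f → Σ (Fin n) λ i → 1 ≤ f i
ΣF-witness (suc n) f pos with f zero in eq
... | suc _ = zero , subst (1 ≤_) (sym eq) (s≤s z≤n)
... | zero  with ΣF-witness n (f ∘ suc) pos
...   | i , p = suc i , p

pigeonhole : ∀ k (c : Fin k → ℕ) t → k * t < ΣF k c → Σ (Fin k) λ i → t < c i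
pigeonhole zero    c t ()
pigeonhole (suc k) c t big with t <? c zero
... | yes lt = zero , lt
... | no ¬lt with pigeonhole k (c ∘ suc) t
                   (+-cancelˡ-< t _ _ (<-≤-trans big (+-monoˡ-≤ _ (≮⇒≥ ¬lt))))
...   | i , lt = suc i , lt

ind : Bool → ℕ
ind true  = 1
ind false = 0

ind-T : ∀ {b} → T b → ind b ≡ 1
ind-T {true} _ = refl

T-ind : ∀ {b} → 1 ≤ ind b → T b
T-ind {true} _ = tt

count-value : ∀ n a → ΣF n (λ i → ind (toℕ i ≡ᵇ a)) ≤ 1
count-value zero    a       = z≤n
count-value (suc n) zero    = ≤-reflexive (cong suc (ΣF-0 n))
count-value (suc n) (suc a) = count-value n a

count-interval : ∀ n L len → ΣF n (λ i → ind ((L ≤ᵇ toℕ i) ∧ (toℕ i <ᵇ L + len))) ≤ len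
count-interval n zero len = below n len
  where
  below : ∀ n len → ΣF n (λ i → ind (toℕ i <ᵇ len)) ≤ len
  below zero    len       = z≤n
  below (suc n) zero      = ≤-reflexive (ΣF-0 n)
  below (suc n) (suc len) = s≤s (below n len)
count-interval zero    (suc L)       len = z≤n
count-interval (suc n) (suc zero)    len = count-interval n zero len
count-interval (suc n) (suc (suc L)) len = count-interval n (suc L) len

fibre : ∀ {n k} → (Fin n → Fin k) → Fin k → ℕ
fibre {n} l i = ΣF n (λ v → ind (sameFin (l v) i))

fibres-partition : ∀ n k (l : Fin n → Fin k) → ΣF k (fibre l) ≡ n
fibres-partition zero    k l = ΣF-0 k
fibres-partition (suc n) k l = begin
  ΣF k (λ i → ind (sameFin (l zero) i) + fibre (l ∘ suc) i)
    ≡⟨ ΣF-+ k _ _ ⟩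
  ΣF k (λ i → ind (sameFin (l zero) i)) + ΣF k (fibre (l ∘ suc))
    ≡⟨ cong₂ _+_ (one-hit k (l zero)) (fibres-partition n k (l ∘ suc)) ⟩
  suc n ∎
  where
  open ≡-Reasoning
  one-hit : ∀ k (j : Fin k) → ΣF k (λ i → ind (sameFin j i)) ≡ 1
  one-hit (suc k) zero    = cong suc (ΣF-0 k)
  one-hit (suc k) (suc j) = one-hit k j

sameFin⇒≡ : ∀ {N} (u v : Fin N) → T (sameFin u v) → toℕ u ≡ toℕ v
sameFin⇒≡ u v = ≡ᵇ⇒≡ (toℕ u) (toℕ v)

sameFin-refl : ∀ {N} (x : Fin N) → T (sameFin x x)
sameFin-refl x = ≡⇒≡ᵇ (toℕ x) (toℕ x) refl

if-T : ∀ {b} {x y : ℕ} → T b → (if b then x else y) ≡ x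
if-T {true} _ = refl

firstStep : ∀ {N} {H : Graph N} {a c : Fin N} (w : Walk H a c) → a ≢ c →
            Σ (Fin N) λ b → T (H a b) × T (usesEdge w a b)
firstStep (stop a)         a≢c = ⊥-elim (a≢c refl)
firstStep {a = a} (step b adj w) _ =
  b , adj , Equivalence.from T-∨ (inj₁ (Equivalence.from T-∨ (inj₁
              (Equivalence.from T-∧ (sameFin-refl a , sameFin-refl b)))))

-- H has maximum degree at most k: the edges at each vertex x can be
-- labelled injectively by Fin k.
DegreeAtMost : ∀ {M} → Graph M → ℕ → Set
DegreeAtMost {M} H k = Σ (Fin M → Fin M → Fin k) λ lab →
  ∀ x y z → T (H x y) → T (H x z) → lab x y ≡ lab x z → y ≡ z

module Congestion {N M : ℕ} {G : Graph N} {H : Graph M} (E : Embedding G H) where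
  open Embedding E

  load : Fin M → Fin M → Fin N → Fin N → ℕ
  load x y u v =
    if toℕ u <ᵇ toℕ v then ifEdge (G u v) (λ e → usesEdge (P u v e) x y) else 0

  EC-f-ΣF : ∀ x y → EC-f E x y ≡ ΣF N (λ u → ΣF N (load x y u))
  EC-f-ΣF x y = trans (sum-allFin N _) (ΣF-cong N (λ u → sum-allFin N (load x y u)))

  load-hit : ∀ x y u v → toℕ u < toℕ v → (e : T (G u v)) →
             T (usesEdge (P u v e) x y) → load x y u v ≡ 1
  load-hit x y u v u<v e uses = trans (if-T (<⇒<ᵇ u<v)) (hit (G u v) _ e uses)
    where
    hit : ∀ b (g : T b → Bool) (e : T b) → T (g e) → ifEdge b g ≡ 1
    hit true g tt t = if-T t

  load-≤ : ∀ x y u v k →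
           (toℕ u < toℕ v → (e : T (G u v)) → T (usesEdge (P u v e) x y) → 1 ≤ k) →
           load x y u v ≤ k
  load-≤ x y u v k routed with toℕ u <ᵇ toℕ v in lt
  ... | false = z≤n
  ... | true  = edge (G u v) _ (routed (<ᵇ⇒< _ _ (subst T (sym lt) tt)))
    where
    edge : ∀ b (g : T b → Bool) → ((e : T b) → T (g e) → 1 ≤ k) → ifEdge b g ≤ k
    edge false g hit = z≤n
    edge true  g hit with g tt in used
    ... | true  = hit tt (subst T (sym used) tt)
    ... | false = z≤n

  load-bound : ∀ x y L len J K extra →
    (∀ u v → toℕ u < toℕ v → (e : T (G u v)) → T (usesEdge (P u v e) x y) →
       (toℕ u ≡ 0 × L ≤ toℕ v × toℕ v < L + len) ⊎ (toℕ u ≡ J × toℕ v ≡ K × 1 ≤ extra)) →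
    EC-f E x y ≤ len + extra
  load-bound x y L len J K extra charged = begin
    EC-f E x y                                 ≡⟨ EC-f-ΣF x y ⟩
    ΣF N (λ u → ΣF N (load x y u))             ≤⟨ ΣF-mono N (λ u → ΣF-mono N (λ v →
                                                    load-≤ x y u v (B u v) (charge u v))) ⟩
    ΣF N (λ u → ΣF N (B u))                    ≤⟨ ΣF-mono N row ⟩
    ΣF N (λ u → hub u * len + pair u * extra)  ≤⟨ column ⟩
    len + extra                                ∎
    where
    open ≤-Reasoning
    hub pair inside end : Fin N → ℕ
    hub    u = ind (toℕ u ≡ᵇ 0)
    pair   u = ind (toℕ u ≡ᵇ J)
    inside v = ind ((L ≤ᵇ toℕ v) ∧ (toℕ v <ᵇ L + len))
    end    v = ind (toℕ v ≡ᵇ K)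

    B : Fin N → Fin N → ℕ
    B u v = inside v * hub u + (end v * extra) * pair u

    charge : ∀ u v → toℕ u < toℕ v → (e : T (G u v)) → T (usesEdge (P u v e) x y) → 1 ≤ B u v
    charge u v u<v e uses with charged u v u<v e uses
    ... | inj₁ (u≡0 , lo , hi)
      rewrite ind-T {toℕ u ≡ᵇ 0} (≡⇒≡ᵇ _ _ u≡0)
            | ind-T {(L ≤ᵇ toℕ v) ∧ (toℕ v <ᵇ L + len)} (Equivalence.from T-∧ (≤⇒≤ᵇ lo , <⇒<ᵇ hi))
      = s≤s z≤n
    ... | inj₂ (u≡J , v≡K , 1≤extra)
      rewrite ind-T {toℕ u ≡ᵇ J} (≡⇒≡ᵇ _ _ u≡J) | ind-T {toℕ v ≡ᵇ K} (≡⇒≡ᵇ _ _ v≡K)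
      = ≤-trans 1≤extra (≤-trans (≤-reflexive (sym (trans (*-identityʳ _) (*-identityˡ extra))))
                                 (m≤n+m _ _))

    row : ∀ u → ΣF N (B u) ≤ hub u * len + pair u * extra
    row u = begin
      ΣF N (B u)
        ≡⟨ ΣF-+ N (λ v → inside v * hub u) (λ v → (end v * extra) * pair u) ⟩
      ΣF N (λ v → inside v * hub u) + ΣF N (λ v → (end v * extra) * pair u)
        ≡⟨ cong₂ _+_ (ΣF-*ʳ N inside (hub u))
                     (trans (ΣF-*ʳ N (λ v → end v * extra) (pair u))
                            (cong (_* pair u) (ΣF-*ʳ N end extra))) ⟩
      ΣF N inside * hub u + (ΣF N end * extra) * pair u
        ≤⟨ +-mono-≤ (*-monoˡ-≤ (hub u) (count-interval N L len))
                    (*-monoˡ-≤ (pair u) (*-monoˡ-≤ extra (count-value N K))) ⟩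
      len * hub u + (1 * extra) * pair u
        ≡⟨ cong₂ _+_ (*-comm len (hub u))
                     (trans (cong (_* pair u) (*-identityˡ extra)) (*-comm extra (pair u))) ⟩
      hub u * len + pair u * extra ∎

    column : ΣF N (λ u → hub u * len + pair u * extra) ≤ len + extra
    column = begin
      ΣF N (λ u → hub u * len + pair u * extra)
        ≡⟨ trans (ΣF-+ N (λ u → hub u * len) (λ u → pair u * extra))
                 (cong₂ _+_ (ΣF-*ʳ N hub len) (ΣF-*ʳ N pair extra)) ⟩
      ΣF N hub * len + ΣF N pair * extra
        ≤⟨ +-mono-≤ (*-monoˡ-≤ len (count-value N 0)) (*-monoˡ-≤ extra (count-value N J)) ⟩
      1 * len + 1 * extra
        ≡⟨ cong₂ _+_ (*-identityˡ len) (*-identityˡ extra) ⟩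
      len + extra ∎

-- The n paths from f(0) leave it along at
-- most k edges, so if n > k·t one of these edges carries more than t paths.
hub-congestion : ∀ {n M k t} {G : Graph (suc n)} {H : Graph M} →
  (∀ v → T (G zero (suc v))) → DegreeAtMost H k → k * t < n →
  (E : Embedding G H) → Σ (Fin M) λ x → Σ (Fin M) λ y → T (H x y) × t < EC-f E x y
hub-congestion {n} {M} {k} {t} {G} {H} hub (lab , lab-inj) n>k*t E =
  f zero , exit v₀ , exit-adj v₀ , (begin-strict
    t                                         <⟨ crowded ⟩
    fibre direction i                         ≤⟨ ΣF-mono n through ⟩
    ΣF n (λ v → busy zero (suc v))            ≤⟨ m≤n+m _ _ ⟩
    ΣF (suc n) (busy zero)                    ≤⟨ ΣF-term (suc n) (λ u → ΣF (suc n) (busy u)) zero ⟩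
    ΣF (suc n) (λ u → ΣF (suc n) (busy u))    ≡⟨ EC-f-ΣF _ _ ⟨
    EC-f E (f zero) (exit v₀)                 ∎)
  where
  open Embedding E
  open Congestion E
  open ≤-Reasoning

  firstEdge : ∀ v → Σ (Fin M) λ b → T (H (f zero) b) × T (usesEdge (P zero (suc v) (hub v)) (f zero) b)
  firstEdge v = firstStep (P zero (suc v) (hub v)) (zero≢suc ∘ f-inj)

  exit : Fin n → Fin M
  exit v = proj₁ (firstEdge v)

  exit-adj : ∀ v → T (H (f zero) (exit v))
  exit-adj v = proj₁ (proj₂ (firstEdge v))

  direction : Fin n → Fin k
  direction v = lab (f zero) (exit v)

  crowdedDirection : Σ (Fin k) λ i → t < fibre direction i
  crowdedDirection = pigeonhole k (fibre direction) t
    (subst (k * t <_) (sym (fibres-partition n k direction)) n>k*t)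

  i : Fin k
  i = proj₁ crowdedDirection

  crowded : t < fibre direction i
  crowded = proj₂ crowdedDirection

  inFibre : ∀ v → T (sameFin (direction v) i) → direction v ≡ i
  inFibre v same = toℕ-injective (sameFin⇒≡ _ _ same)

  member : Σ (Fin n) λ v → 1 ≤ ind (sameFin (direction v) i)
  member = ΣF-witness n _ (≤-trans (s≤s z≤n) crowded)

  v₀ : Fin n
  v₀ = proj₁ member

  v₀-direction : direction v₀ ≡ i
  v₀-direction = inFibre v₀ (T-ind (proj₂ member))

  busy : Fin (suc n) → Fin (suc n) → ℕ
  busy = load (f zero) (exit v₀)

  through : ∀ v → ind (sameFin (direction v) i) ≤ busy zero (suc v)
  through v with sameFin (direction v) i in same
  ... | false = z≤n
  ... | true  = ≤-reflexive (sym (load-hit _ _ zero (suc v) (s≤s z≤n) (hub v) uses))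
    where
    sameExit : exit v ≡ exit v₀
    sameExit = lab-inj (f zero) _ _ (exit-adj v) (exit-adj v₀)
                 (trans (inFibre v (subst T (sym same) tt)) (sym v₀-direction))
    uses : T (usesEdge (P zero (suc v) (hub v)) (f zero) (exit v₀))
    uses = subst (λ b → T (usesEdge (P zero (suc v) (hub v)) (f zero) b)) sameExit
                 (proj₂ (proj₂ (firstEdge v)))

Pair : ℕ → ℕ → ℕ → ℕ → Set
Pair a b X Y = (a ≡ X × b ≡ Y) ⊎ (a ≡ Y × b ≡ X)

Pair-sym : ∀ {a b X Y} → Pair a b X Y → Pair b a X Y
Pair-sym (inj₁ (a≡X , b≡Y)) = inj₂ (b≡Y , a≡X)
Pair-sym (inj₂ (a≡Y , b≡X)) = inj₁ (b≡X , a≡Y)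

UnitStep : ℕ → ℕ → ℕ → Set
UnitStep j X Y = Pair j (suc j) X Y

Consecutive : ℕ → List ℕ → ℕ → ℕ → Set
Consecutive A []      X Y = ⊥
Consecutive A (B ∷ l) X Y = Pair A B X Y ⊎ Consecutive B l X Y

-- ascending run A + 1, …, A + k (continuing a walk that stands at A)
ups : ℕ → ℕ → List ℕ
ups A zero    = []
ups A (suc k) = suc A ∷ ups (suc A) k

-- descending run k + A - 1, …, A (continuing a walk that stands at k + A)
dns : ℕ → ℕ → List ℕ
dns A zero    = []
dns A (suc k) = (k + A) ∷ dns A k

ups-range : ∀ A k → All (λ z → A < z × z ≤ A + k) (ups A k)
ups-range A zero    = []
ups-range A (suc k) = (≤-refl , A+1≤A+sk)
  ∷ All.map (λ {z} (lo , hi) → <-trans (n<1+n A) lo , subst (z ≤_) (sym (+-suc A k)) hi)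
            (ups-range (suc A) k)
  where
  A+1≤A+sk : suc A ≤ A + suc k
  A+1≤A+sk = subst (suc A ≤_) (sym (+-suc A k)) (s≤s (m≤m+n A k))

dns-range : ∀ A k → All (λ z → A ≤ z × z < k + A) (dns A k)
dns-range A zero    = []
dns-range A (suc k) = (m≤n+m A k , ≤-refl)
  ∷ All.map (λ (lo , hi) → lo , <-trans hi (n<1+n _)) (dns-range A k)

unique-∷-min : ∀ a l → All (a <_) l → Unique l → Unique (a ∷ l)
unique-∷-min a l below u = All.map (λ lt eq → <-irrefl eq lt) below AllPairs.∷ u

unique-∷-max : ∀ a l → All (_< a) l → Unique l → Unique (a ∷ l)
unique-∷-max a l above u = All.map (λ lt eq → <-irrefl (sym eq) lt) above AllPairs.∷ u

unique-snoc-min : ∀ a l → All (a <_) l → Unique l → Unique (l ++ a ∷ [])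
unique-snoc-min a []      []           AllPairs.[]       = [] AllPairs.∷ AllPairs.[]
unique-snoc-min a (x ∷ l) (a<x ∷ below) (x∉l AllPairs.∷ u) =
  snoc x∉l (λ eq → <-irrefl (sym eq) a<x) AllPairs.∷ unique-snoc-min a l below u
  where
  snoc : ∀ {m} → All (x ≢_) m → x ≢ a → All (x ≢_) (m ++ a ∷ [])
  snoc []         x≢a = x≢a ∷ []
  snoc (p ∷ ps)   x≢a = p ∷ snoc ps x≢a

ups-unique : ∀ A k → Unique (ups A k)
ups-unique A zero    = AllPairs.[]
ups-unique A (suc k) = unique-∷-min (suc A) _ (All.map proj₁ (ups-range (suc A) k)) (ups-unique (suc A) k)

dns-unique : ∀ A k → Unique (dns A k)
dns-unique A zero    = AllPairs.[]
dns-unique A (suc k) = unique-∷-max (k + A) _ (All.map proj₂ (dns-range A k)) (dns-unique A k)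

ups-steps : ∀ A k X Y → Consecutive A (ups A k) X Y →
            Σ ℕ λ j → A ≤ j × j < A + k × UnitStep j X Y
ups-steps A (suc k) X Y (inj₁ p) = A , ≤-refl , subst (A <_) (sym (+-suc A k)) (s≤s (m≤m+n A k)) , p
ups-steps A (suc k) X Y (inj₂ c) with ups-steps (suc A) k X Y c
... | j , lo , hi , p = j , ≤-trans (n≤1+n A) lo , subst (j <_) (sym (+-suc A k)) hi , p

dns-steps : ∀ A k X Y → Consecutive (k + A) (dns A k) X Y →
            Σ ℕ λ j → A ≤ j × j < k + A × UnitStep j X Y
dns-steps A (suc k) X Y (inj₁ p) = k + A , m≤n+m A k , ≤-refl , Pair-sym p
dns-steps A (suc k) X Y (inj₂ c) with dns-steps A k X Y c
... | j , lo , hi , p = j , lo , <-trans hi (n<1+n _) , p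

module ListWalk {N : ℕ} (H : Graph N) (Adj : ℕ → ℕ → Set)
                (toH : ∀ x y → Adj (toℕ x) (toℕ y) → T (H x y)) where

  Chain : ℕ → List ℕ → ℕ → Set
  Chain A []      C = A ≡ C
  Chain A (B ∷ l) C = B < N × Adj A B × Chain B l C

  Chain-++ : ∀ A l B l' C → Chain A l B → Chain B l' C → Chain A (l ++ l') C
  Chain-++ A []      B l' C refl            ch' = ch'
  Chain-++ A (x ∷ l) B l' C (lt , adj , ch) ch' = lt , adj , Chain-++ x l B l' C ch ch'

  Chain-from : ∀ {A A'} l C → A ≡ A' → Chain A l C → Chain A' l C
  Chain-from l C refl ch = ch

  ups-chain : (∀ X → suc X < N → Adj X (suc X)) →
              ∀ A k C → A + k ≡ C → C < N → Chain A (ups A k) C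
  ups-chain up A zero    C eq lt = trans (sym (+-identityʳ A)) eq
  ups-chain up A (suc k) C eq lt =
    A+1<N , up A A+1<N , ups-chain up (suc A) k C (trans (sym (+-suc A k)) eq) lt
    where
    A+1<N : suc A < N
    A+1<N = ≤-<-trans (subst (suc A ≤_) eq (subst (suc A ≤_) (sym (+-suc A k)) (s≤s (m≤m+n A k)))) lt

  dns-chain : (∀ Y → suc Y < N → Adj (suc Y) Y) →
              ∀ A k → k + A < N → Chain (k + A) (dns A k) A
  dns-chain down A zero    lt = refl
  dns-chain down A (suc k) lt = k+A<N , down (k + A) lt , dns-chain down A k k+A<N
    where
    k+A<N : k + A < N
    k+A<N = <-trans (n<1+n _) lt

  stopAt : ∀ {a c : Fin N} → a ≡ c → Walk H a c
  stopAt {a} refl = stop a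

  walkOf : (a : Fin N) (l : List ℕ) (c : Fin N) → Chain (toℕ a) l (toℕ c) → Walk H a c
  walkOf a []      c eq = stopAt (toℕ-injective eq)
  walkOf a (B ∷ l) c (lt , adj , ch) =
    step b (toH a b (subst (Adj (toℕ a)) (sym (toℕ-fromℕ< lt)) adj))
           (walkOf b l c (subst (λ z → Chain z l (toℕ c)) (sym (toℕ-fromℕ< lt)) ch))
    where
    b : Fin N
    b = fromℕ< lt

  walkOf-vertices : ∀ a l c ch → map toℕ (vertices (walkOf a l c ch)) ≡ toℕ a ∷ l
  walkOf-vertices a []      c eq = stopAt-vertices (toℕ-injective eq)
    where
    stopAt-vertices : ∀ {a c : Fin N} (eq : a ≡ c) → map toℕ (vertices (stopAt eq)) ≡ toℕ a ∷ []
    stopAt-vertices refl = refl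
  walkOf-vertices a (B ∷ l) c (lt , adj , ch) =
    cong (toℕ a ∷_) (trans (walkOf-vertices (fromℕ< lt) l c _) (cong (_∷ l) (toℕ-fromℕ< lt)))

  walkOf-path : ∀ a l c ch → Unique (toℕ a ∷ l) → IsPath (walkOf a l c ch)
  walkOf-path a l c ch u =
    AllPairs.map (λ ne eq → ne (cong toℕ eq))
                 (AllPairs.map⁻ (subst Unique (sym (walkOf-vertices a l c ch)) u))

  walkOf-uses : ∀ a l c ch x y → T (usesEdge (walkOf a l c ch) x y) →
                Consecutive (toℕ a) l (toℕ x) (toℕ y)
  walkOf-uses a []      c eq x y t = stopAt-uses (toℕ-injective eq) t
    where
    stopAt-uses : ∀ {a c : Fin N} (eq : a ≡ c) → T (usesEdge (stopAt eq) x y) → ⊥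
    stopAt-uses refl ()
  walkOf-uses a (B ∷ l) c (lt , adj , ch) x y t with Equivalence.to T-∨ t
  ... | inj₂ later = inj₂ (subst (λ z → Consecutive z l (toℕ x) (toℕ y)) (toℕ-fromℕ< lt)
                                 (walkOf-uses (fromℕ< lt) l c _ x y later))
  ... | inj₁ here with Equivalence.to T-∨ here
  ...   | inj₁ forward  = let (ax , by) = Equivalence.to T-∧ forward in
          inj₁ (inj₁ (sameFin⇒≡ a x ax , trans (sym (toℕ-fromℕ< lt)) (sameFin⇒≡ _ y by)))
  ...   | inj₂ backward = let (ay , bx) = Equivalence.to T-∧ backward in
          inj₁ (inj₂ (sameFin⇒≡ a y ay , trans (sym (toℕ-fromℕ< lt)) (sameFin⇒≡ _ x bx)))

module Cyclic (N : ℕ) .{{_ : NonZero N}} where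

  diff : ℕ → ℕ → ℕ
  diff X Y = (Y + N ∸ X) % N

  diff-≤ : ∀ {X Y} → X ≤ Y → Y < N → diff X Y ≡ Y ∸ X
  diff-≤ {X} {Y} X≤Y Y<N = begin
    (Y + N ∸ X) % N ≡⟨ cong (_% N) (+-∸-comm N X≤Y) ⟩
    (Y ∸ X + N) % N ≡⟨ [m+n]%n≡m%n (Y ∸ X) N ⟩
    (Y ∸ X) % N     ≡⟨ m<n⇒m%n≡m (≤-<-trans (m∸n≤m Y X) Y<N) ⟩
    Y ∸ X           ∎
    where open ≡-Reasoning

  diff-> : ∀ {X Y} → Y < X → diff X Y ≡ Y + N ∸ X
  diff-> {X} {Y} Y<X = m<n⇒m%n≡m (m<n+o⇒m∸n<o (Y + N) X (+-monoˡ-< N Y<X))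

  diff-no-mix : ∀ {A B C} → A < N → A ≤ B → B < N → C < A → diff A B ≢ diff A C
  diff-no-mix {A} {B} {C} A<N A≤B B<N C<A eq = <⇒≱ B<N (subst (N ≤_) (sym B≡C+N) (m≤n+m N C))
    where
    B≡C+N : B ≡ C + N
    B≡C+N = begin
      B             ≡⟨ m∸n+n≡m A≤B ⟨
      B ∸ A + A     ≡⟨ cong (_+ A) (trans (sym (diff-≤ A≤B B<N)) (trans eq (diff-> C<A))) ⟩
      C + N ∸ A + A ≡⟨ m∸n+n≡m (≤-trans (<⇒≤ A<N) (m≤n+m N C)) ⟩
      C + N         ∎
      where open ≡-Reasoning

  diff-injective : ∀ {A B C} → A < N → B < N → C < N → diff A B ≡ diff A C → B ≡ C
  diff-injective {A} {B} {C} A<N B<N C<N eq with A ≤? B | A ≤? C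
  ... | yes A≤B | yes A≤C =
    ∸-cancelʳ-≡ A≤B A≤C (trans (sym (diff-≤ A≤B B<N)) (trans eq (diff-≤ A≤C C<N)))
  ... | no A≰B  | no A≰C  =
    +-cancelʳ-≡ N B C (∸-cancelʳ-≡ (≤-trans (<⇒≤ A<N) (m≤n+m N B)) (≤-trans (<⇒≤ A<N) (m≤n+m N C))
      (trans (sym (diff-> (≰⇒> A≰B))) (trans eq (diff-> (≰⇒> A≰C)))))
  ... | yes A≤B | no A≰C  = ⊥-elim (diff-no-mix A<N A≤B B<N (≰⇒> A≰C) eq)
  ... | no A≰B  | yes A≤C = ⊥-elim (diff-no-mix A<N A≤C C<N (≰⇒> A≰B) (sym eq))

n≢2+n : ∀ n → n ≢ suc (suc n)
n≢2+n n = <⇒≢ (<-trans (n<1+n n) (n<1+n (suc n)))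

T-not : ∀ {b} → T (not b) → ¬ T b
T-not {false} _ ()

-- Edges of the windmill: every edge meets the hub 0 or lies in a blade
-- {2i - 1 , 2i}, i.e. its ends have the same value of ⌊(v + 1)/2⌋.
friend-edge : ∀ U V → T (friendAdj U V) →
              U ≢ V × (U ≡ 0 ⊎ V ≡ 0 ⊎ suc U / 2 ≡ suc V / 2)
friend-edge U V t with Equivalence.to T-∧ t
... | distinct , meets =
  (λ U≡V → T-not distinct (≡⇒≡ᵇ U V U≡V)) ,
  Sum.map (≡ᵇ⇒≡ U 0) (Sum.map (≡ᵇ⇒≡ V 0) (≡ᵇ⇒≡ _ _) ∘ Equivalence.to T-∨)
          (Equivalence.to T-∨ meets)

same-half : ∀ a b → a / 2 ≡ b / 2 → a < b → b ≡ suc a × a ≡ (a / 2) * 2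
same-half a b eq a<b =
  split (a % 2) (b % 2) (m%n<n a 2) (m%n<n b 2) (m≡m%n+[m/n]*n a 2)
        (subst (λ k → b ≡ b % 2 + k * 2) (sym eq) (m≡m%n+[m/n]*n b 2))
  where
  k : ℕ
  k = a / 2
  split : ∀ ra rb → ra < 2 → rb < 2 → a ≡ ra + k * 2 → b ≡ rb + k * 2 → b ≡ suc a × a ≡ k * 2
  split 0 1 _ _ ea eb = trans eb (cong suc (sym ea)) , ea
  split 0 0 _ _ ea eb = ⊥-elim (<-irrefl (trans ea (sym eb)) a<b)
  split 1 1 _ _ ea eb = ⊥-elim (<-irrefl (trans ea (sym eb)) a<b)
  split 1 0 _ _ ea eb = ⊥-elim (<-asym a<b (subst₂ _<_ (sym eb) (sym ea) ≤-refl))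
  split (suc (suc _)) _ (s≤s (s≤s ())) _ _ _
  split _ (suc (suc _)) _ (s≤s (s≤s ())) _ _

odd≢even : ∀ m k → suc (2 * m) ≢ k * 2
odd≢even m k eq = 1+n≢0 (begin
  1                  ≡⟨ [m+kn]%n≡m%n 1 m 2 ⟨
  (1 + m * 2) % 2    ≡⟨ cong (λ z → suc z % 2) (*-comm m 2) ⟩
  suc (2 * m) % 2    ≡⟨ cong (_% 2) eq ⟩
  (k * 2) % 2        ≡⟨ m*n%n≡0 k 2 ⟩
  0                  ∎)
  where open ≡-Reasoning

-- The theorem's graphs for q = 2p with p ≥ 1 (q = 2^(n-2)): G = WM_{2q} and
-- H = G(4q ; ±{1 , q}), both on N = 4q vertices.
module Windmill (s : ℕ) where
  p q r q2 q3 N : ℕ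
  p  = suc s
  q  = 2 * p
  r  = pred q      -- q = suc r holds by computation
  q2 = q + q
  q3 = q2 + q
  N  = 2 * (2 * q)

  instance
    N-nonZero : NonZero N
    N-nonZero = _

  open Cyclic N

  G H : Graph N
  G = windmill (2 * q)
  H = circulant N (1 ∷ q ∷ [])

  N≡q3+q : N ≡ q3 + q
  N≡q3+q = four q
    where
    four : ∀ x → 2 * (2 * x) ≡ ((x + x) + x) + x
    four = solve-∀

  N∸1≡q3+r : N ∸ 1 ≡ q3 + r
  N∸1≡q3+r = cong pred (trans N≡q3+q (+-suc q3 r))

  0<q : 0 < q
  0<q = s≤s z≤n

  0<r : 0 < r
  0<r = ≤-trans (s≤s z≤n) (m≤n+m (1 * p) s)

  q≤q2 : q ≤ q2
  q≤q2 = m≤m+n q q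

  q2≤q3 : q2 ≤ q3
  q2≤q3 = m≤m+n q2 q

  q<q3 : q < q3
  q<q3 = <-≤-trans (m<m+n q 0<q) q2≤q3

  q3<N∸1 : q3 < N ∸ 1
  q3<N∸1 = subst (q3 <_) (sym N∸1≡q3+r) (m<m+n q3 0<r)

  N∸1<N : N ∸ 1 < N
  N∸1<N = n<1+n (N ∸ 1)

  q3<N : q3 < N
  q3<N = <-trans q3<N∸1 N∸1<N

  q<N : q < N
  q<N = <-trans q<q3 q3<N

  1<N : 1 < N
  1<N = ≤-<-trans 0<q q<N

  N∸q≡q3 : N ∸ q ≡ q3
  N∸q≡q3 = trans (cong (_∸ q) N≡q3+q) (m+n∸n≡m q3 q)

  N∸q3≡q : N ∸ q3 ≡ q
  N∸q3≡q = trans (cong (_∸ q3) N≡q3+q) (m+n∸m≡n q3 q)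

  StepSize : ℕ → Set
  StepSize d = (d ≡ 1 ⊎ d ≡ N ∸ 1) ⊎ (d ≡ q ⊎ d ≡ N ∸ q)

  Adj : ℕ → ℕ → Set
  Adj X Y = StepSize (diff X Y)

  private
    small : ∀ {d} e → e < N → T (d ≡ᵇ e % N) → d ≡ e
    small {d} e e<N t = trans (≡ᵇ⇒≡ d (e % N) t) (m<n⇒m%n≡m e<N)

    small⁻¹ : ∀ {d} e → e < N → d ≡ e → T (d ≡ᵇ e % N)
    small⁻¹ {d} e e<N d≡e = ≡⇒≡ᵇ d (e % N) (trans d≡e (sym (m<n⇒m%n≡m e<N)))

    N∸q<N : N ∸ q < N
    N∸q<N = subst (_< N) (sym N∸q≡q3) q3<N

  -- Both directions need the offsets 1, N - 1, q, N - q to be below N.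
  H⇒Adj : ∀ x y → T (H x y) → Adj (toℕ x) (toℕ y)
  H⇒Adj x y adj =
    Sum.map (Sum.map (small 1 1<N) (small (N ∸ 1) N∸1<N) ∘ Equivalence.to T-∨)
            (Sum.map (small q q<N) (small (N ∸ q) N∸q<N) ∘ Equivalence.to T-∨ ∘ subst T (∨-identityʳ _))
            (Equivalence.to T-∨ adj)

  Adj⇒H : ∀ x y → Adj (toℕ x) (toℕ y) → T (H x y)
  Adj⇒H x y adj = Equivalence.from T-∨
    (Sum.map (Equivalence.from T-∨ ∘ Sum.map (small⁻¹ 1 1<N) (small⁻¹ (N ∸ 1) N∸1<N))
             (subst T (sym (∨-identityʳ _)) ∘ Equivalence.from T-∨ ∘ Sum.map (small⁻¹ q q<N) (small⁻¹ (N ∸ q) N∸q<N))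
             adj)

  -- H is 4-regular: the edges at x are labelled by their step.
  stepIndex : ℕ → Fin 4
  stepIndex d with d ≟ 1 | d ≟ N ∸ 1 | d ≟ q
  ... | yes _ | _     | _     = # 0
  ... | no _  | yes _ | _     = # 1
  ... | no _  | no _  | yes _ = # 2
  ... | no _  | no _  | no _  = # 3

  stepOf : Fin 4 → ℕ
  stepOf zero                   = 1
  stepOf (suc zero)             = N ∸ 1
  stepOf (suc (suc zero))       = q
  stepOf (suc (suc (suc zero))) = N ∸ q

  stepOf-index : ∀ d → StepSize d → stepOf (stepIndex d) ≡ d
  stepOf-index d st with d ≟ 1 | d ≟ N ∸ 1 | d ≟ q
  ... | yes d≡1 | _       | _   = sym d≡1
  ... | no _    | yes d≡  | _   = sym d≡
  ... | no _    | no _    | yes d≡q = sym d≡q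
  ... | no d≢1  | no d≢   | no d≢q with st
  ...   | inj₁ (inj₁ d≡1) = ⊥-elim (d≢1 d≡1)
  ...   | inj₁ (inj₂ d≡)  = ⊥-elim (d≢ d≡)
  ...   | inj₂ (inj₁ d≡q) = ⊥-elim (d≢q d≡q)
  ...   | inj₂ (inj₂ d≡)  = sym d≡

  -- Neighbours of x with the same step label have the same difference to x,
  -- hence coincide.
  degree≤4 : DegreeAtMost H 4
  degree≤4 = (λ x y → stepIndex (diff (toℕ x) (toℕ y))) , distinct
    where
    distinct : ∀ x y z → T (H x y) → T (H x z) →
               stepIndex (diff (toℕ x) (toℕ y)) ≡ stepIndex (diff (toℕ x) (toℕ z)) → y ≡ z
    distinct x y z xy xz same = toℕ-injective (diff-injective (toℕ<n x) (toℕ<n y) (toℕ<n z) (begin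
      diff (toℕ x) (toℕ y)                   ≡⟨ stepOf-index _ (H⇒Adj x y xy) ⟨
      stepOf (stepIndex (diff (toℕ x) (toℕ y))) ≡⟨ cong stepOf same ⟩
      stepOf (stepIndex (diff (toℕ x) (toℕ z))) ≡⟨ stepOf-index _ (H⇒Adj x z xz) ⟩
      diff (toℕ x) (toℕ z)                   ∎))
      where open ≡-Reasoning

  up : ∀ X → suc X < N → Adj X (suc X)
  up X lt = inj₁ (inj₁ (trans (diff-≤ (n≤1+n X) lt) (m+n∸n≡m 1 X)))

  down : ∀ Y → suc Y < N → Adj (suc Y) Y
  down Y lt = inj₁ (inj₂ (trans (diff-> (n<1+n Y)) (back Y)))
    where
    back : ∀ Y → Y + N ∸ suc Y ≡ N ∸ 1
    back zero    = refl
    back (suc Y) = back Y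

  hop-0q : Adj 0 q
  hop-0q = inj₂ (inj₁ (diff-≤ z≤n q<N))

  hop-0q3 : Adj 0 q3
  hop-0q3 = inj₂ (inj₂ (trans (diff-≤ z≤n q3<N) (sym N∸q≡q3)))

  hop-0N∸1 : Adj 0 (N ∸ 1)
  hop-0N∸1 = inj₁ (inj₂ (diff-≤ z≤n N∸1<N))

  hop-q0 : Adj q 0
  hop-q0 = inj₂ (inj₂ (diff-> 0<q))

  hop-q30 : Adj q3 0
  hop-q30 = inj₂ (inj₁ (trans (diff-> (<-trans 0<q q<q3)) N∸q3≡q))

  hop-N∸10 : Adj (N ∸ 1) 0
  hop-N∸10 = inj₁ (inj₁ (trans (diff-> (<-trans 0<q (<-trans q<q3 q3<N∸1))) (m+n∸n≡m 1 (N ∸ 1))))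

  open ListWalk H Adj Adj⇒H

  -- The route from the hub 0 to V (as the vertex sequence after 0), chosen by
  -- comparing V with q, 2q and 3q: up the cycle if V ≤ q; hop to q and go up
  -- if V ≤ 2q; hop to 3q and go down if V ≤ 3q; otherwise hop to N - 1 and go
  -- down.  (The comparisons are explicit arguments, so that proofs about the
  -- routes are plain case analyses.)
  hubRouteBy : ∀ V → Dec (V ≤ q) → Dec (V ≤ q2) → Dec (V ≤ q3) → List ℕ
  hubRouteBy V (yes _) _       _       = ups 0 V
  hubRouteBy V (no _)  (yes _) _       = q ∷ ups q (V ∸ q)
  hubRouteBy V (no _)  (no _)  (yes _) = q3 ∷ dns V (q3 ∸ V)
  hubRouteBy V (no _)  (no _)  (no _)  = (N ∸ 1) ∷ dns V (N ∸ 1 ∸ V)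

  hubRoute : ℕ → List ℕ
  hubRoute V = hubRouteBy V (V ≤? q) (V ≤? q2) (V ≤? q3)

  backRouteBy : ∀ U → Dec (U ≤ q) → Dec (U ≤ q2) → Dec (U ≤ q3) → List ℕ
  backRouteBy U (yes _) _       _       = dns 0 U
  backRouteBy U (no _)  (yes _) _       = dns q (U ∸ q) ++ 0 ∷ []
  backRouteBy U (no _)  (no _)  (yes _) = ups U (q3 ∸ U) ++ 0 ∷ []
  backRouteBy U (no _)  (no _)  (no _)  = ups U (N ∸ 1 ∸ U) ++ 0 ∷ []

  backRoute : ℕ → List ℕ
  backRoute U = backRouteBy U (U ≤? q) (U ≤? q2) (U ≤? q3)

  hubRoute-chain : ∀ V → V < N → Chain 0 (hubRoute V) V
  hubRoute-chain V V<N = go (V ≤? q) (V ≤? q2) (V ≤? q3)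
    where
    V≤N∸1 : V ≤ N ∸ 1
    V≤N∸1 = <⇒≤pred V<N
    go : ∀ d₁ d₂ d₃ → Chain 0 (hubRouteBy V d₁ d₂ d₃) V
    go (yes _)  _       _          = ups-chain up 0 V V refl V<N
    go (no V≰q) (yes _) _          = q<N , hop-0q , ups-chain up q (V ∸ q) V (m+[n∸m]≡n (<⇒≤ (≰⇒> V≰q))) V<N
    go (no _)   (no _)  (yes V≤q3) = q3<N , hop-0q3 ,
      Chain-from _ V (m∸n+n≡m V≤q3) (dns-chain down V (q3 ∸ V) (subst (_< N) (sym (m∸n+n≡m V≤q3)) q3<N))
    go (no _)   (no _)  (no _)     = N∸1<N , hop-0N∸1 ,
      Chain-from _ V (m∸n+n≡m V≤N∸1) (dns-chain down V (N ∸ 1 ∸ V) (subst (_< N) (sym (m∸n+n≡m V≤N∸1)) N∸1<N))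

  backRoute-chain : ∀ U → U < N → Chain U (backRoute U) 0
  backRoute-chain U U<N = go (U ≤? q) (U ≤? q2) (U ≤? q3)
    where
    go : ∀ d₁ d₂ d₃ → Chain U (backRouteBy U d₁ d₂ d₃) 0
    go (yes _)  _       _          =
      Chain-from _ 0 (+-identityʳ U) (dns-chain down 0 U (subst (_< N) (sym (+-identityʳ U)) U<N))
    go (no U≰q) (yes _) _          = Chain-++ U _ q _ 0
      (Chain-from _ q (m∸n+n≡m q≤U) (dns-chain down q (U ∸ q) (subst (_< N) (sym (m∸n+n≡m q≤U)) U<N)))
      (s≤s z≤n , hop-q0 , refl)
      where
      q≤U : q ≤ U
      q≤U = <⇒≤ (≰⇒> U≰q)
    go (no _)   (no _)  (yes U≤q3) = Chain-++ U _ q3 _ 0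
      (ups-chain up U (q3 ∸ U) q3 (m+[n∸m]≡n U≤q3) q3<N) (s≤s z≤n , hop-q30 , refl)
    go (no _)   (no _)  (no _)     = Chain-++ U _ (N ∸ 1) _ 0
      (ups-chain up U (N ∸ 1 ∸ U) (N ∸ 1) (m+[n∸m]≡n (<⇒≤pred U<N)) N∸1<N) (s≤s z≤n , hop-N∸10 , refl)

  -- Routes never revisit a vertex: each is a monotone run after (or before)
  -- a single hop, and the runs stay strictly on one side of the hop.
  hubRoute-unique : ∀ V → V < N → Unique (0 ∷ hubRoute V)
  hubRoute-unique V V<N = go (V ≤? q) (V ≤? q2) (V ≤? q3)
    where
    go : ∀ d₁ d₂ d₃ → Unique (0 ∷ hubRouteBy V d₁ d₂ d₃)
    go (yes _)  _       _          = unique-∷-min 0 _ (All.map proj₁ (ups-range 0 V)) (ups-unique 0 V)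
    go (no V≰q) (yes _) _          =
      unique-∷-min 0 _ (0<q ∷ All.map (<-trans 0<q ∘ proj₁) (ups-range q (V ∸ q)))
        (unique-∷-min q _ (All.map proj₁ (ups-range q (V ∸ q))) (ups-unique q (V ∸ q)))
    go (no V≰q) (no _)  (yes V≤q3) =
      unique-∷-min 0 _ (<-trans 0<q q<q3 ∷ All.map (<-≤-trans (<-trans 0<q (≰⇒> V≰q)) ∘ proj₁) (dns-range V (q3 ∸ V)))
        (unique-∷-max q3 _ (All.map (λ {z} → subst (z <_) (m∸n+n≡m V≤q3) ∘ proj₂) (dns-range V (q3 ∸ V)))
                      (dns-unique V (q3 ∸ V)))
    go (no V≰q) (no _)  (no _)     =
      unique-∷-min 0 _ (<-trans 0<q (<-trans q<q3 q3<N∸1)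
                         ∷ All.map (<-≤-trans (<-trans 0<q (≰⇒> V≰q)) ∘ proj₁) (dns-range V (N ∸ 1 ∸ V)))
        (unique-∷-max (N ∸ 1) _ (All.map (λ {z} → subst (z <_) (m∸n+n≡m (<⇒≤pred V<N)) ∘ proj₂)
                                         (dns-range V (N ∸ 1 ∸ V)))
                      (dns-unique V (N ∸ 1 ∸ V)))

  backRoute-unique : ∀ U → 0 < U → U < N → Unique (U ∷ backRoute U)
  backRoute-unique U 0<U U<N = go (U ≤? q) (U ≤? q2) (U ≤? q3)
    where
    go : ∀ d₁ d₂ d₃ → Unique (U ∷ backRouteBy U d₁ d₂ d₃)
    go (yes _)  _       _      =
      unique-∷-max U _ (All.map (λ {z} → subst (z <_) (+-identityʳ U) ∘ proj₂) (dns-range 0 U)) (dns-unique 0 U)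
    go (no U≰q) (yes _) _      =
      unique-snoc-min 0 (U ∷ dns q (U ∸ q)) (0<U ∷ All.map (<-≤-trans 0<q ∘ proj₁) (dns-range q (U ∸ q)))
        (unique-∷-max U _ (All.map (λ {z} → subst (z <_) (m∸n+n≡m (<⇒≤ (≰⇒> U≰q))) ∘ proj₂) (dns-range q (U ∸ q)))
                      (dns-unique q (U ∸ q)))
    go (no _)   (no _)  (yes _) =
      unique-snoc-min 0 (U ∷ ups U (q3 ∸ U)) (0<U ∷ All.map (<-trans 0<U ∘ proj₁) (ups-range U (q3 ∸ U)))
        (unique-∷-min U _ (All.map proj₁ (ups-range U (q3 ∸ U))) (ups-unique U (q3 ∸ U)))
    go (no _)   (no _)  (no _)  =
      unique-snoc-min 0 (U ∷ ups U (N ∸ 1 ∸ U)) (0<U ∷ All.map (<-trans 0<U ∘ proj₁) (ups-range U (N ∸ 1 ∸ U)))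
        (unique-∷-min U _ (All.map proj₁ (ups-range U (N ∸ 1 ∸ U))) (ups-unique U (N ∸ 1 ∸ U)))

  blade : ∀ U V → U ≢ 0 → V ≢ 0 → T (friendAdj U V) → suc U / 2 ≡ suc V / 2
  blade U V U≢0 V≢0 t with proj₂ (friend-edge U V t)
  ... | inj₁ U≡0        = ⊥-elim (U≢0 U≡0)
  ... | inj₂ (inj₁ V≡0) = ⊥-elim (V≢0 V≡0)
  ... | inj₂ (inj₂ eq)  = eq

  blade-step : ∀ U V → suc U / 2 ≡ suc V / 2 → U < V → V ≡ suc U
  blade-step U V eq U<V = suc-injective (proj₁ (same-half (suc U) (suc V) eq (s≤s U<V)))

  -- ... and its lower end is odd, hence differs from the even number q.
  blade-start≢q : ∀ U V → suc U / 2 ≡ suc V / 2 → U < V → U ≢ q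
  blade-start≢q U V eq U<V U≡q =
    odd≢even p (suc U / 2) (trans (cong suc (sym U≡q)) (proj₂ (same-half (suc U) (suc V) eq (s≤s U<V))))

  blade-adj : ∀ U V → U < N → V < N → U ≢ 0 → V ≢ 0 → T (friendAdj U V) → Adj U V
  blade-adj U V U<N V<N U≢0 V≢0 t = by (<-cmp U V)
    where
    by : Tri (U < V) (U ≡ V) (V < U) → Adj U V
    by (tri< U<V _ _) = subst (Adj U) (sym V≡U+1) (up U (subst (_< N) V≡U+1 V<N))
      where
      V≡U+1 : V ≡ suc U
      V≡U+1 = blade-step U V (blade U V U≢0 V≢0 t) U<V
    by (tri≈ _ U≡V _) = ⊥-elim (proj₁ (friend-edge U V t) U≡V)
    by (tri> _ _ V<U) = subst (λ z → Adj z V) (sym U≡V+1) (down V (subst (_< N) U≡V+1 U<N))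
      where
      U≡V+1 : U ≡ suc V
      U≡V+1 = blade-step V U (sym (blade U V U≢0 V≢0 t)) V<U

  routeBy : ∀ U V → Dec (U ≡ 0) → Dec (V ≡ 0) → List ℕ
  routeBy U V (yes _) _       = hubRoute V
  routeBy U V (no _)  (yes _) = backRoute U
  routeBy U V (no _)  (no _)  = V ∷ []

  route : ℕ → ℕ → List ℕ
  route U V = routeBy U V (U ≟ 0) (V ≟ 0)

  route-chain : ∀ U V → U < N → V < N → T (friendAdj U V) → Chain U (route U V) V
  route-chain U V U<N V<N t = go (U ≟ 0) (V ≟ 0)
    where
    go : ∀ d₁ d₂ → Chain U (routeBy U V d₁ d₂) V
    go (yes refl) _          = hubRoute-chain V V<N
    go (no _)     (yes refl) = backRoute-chain U U<N
    go (no U≢0)   (no V≢0)   = V<N , blade-adj U V U<N V<N U≢0 V≢0 t , refl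

  route-unique : ∀ U V → U < N → V < N → T (friendAdj U V) → Unique (U ∷ route U V)
  route-unique U V U<N V<N t = go (U ≟ 0) (V ≟ 0)
    where
    go : ∀ d₁ d₂ → Unique (U ∷ routeBy U V d₁ d₂)
    go (yes refl) _          = hubRoute-unique V V<N
    go (no U≢0)   (yes refl) = backRoute-unique U (n≢0⇒n>0 U≢0) U<N
    go (no _)     (no _)     = (proj₁ (friend-edge U V t) ∷ []) AllPairs.∷ ([] AllPairs.∷ AllPairs.[])

  embedding : Embedding G H
  embedding = record
    { f      = λ x → x
    ; f-inj  = λ eq → eq
    ; P      = λ u v e → walkOf u (route (toℕ u) (toℕ v)) v (route-chain (toℕ u) (toℕ v) (toℕ<n u) (toℕ<n v) e)
    ; P-path = λ u v e → walkOf-path u _ v _ (route-unique (toℕ u) (toℕ v) (toℕ<n u) (toℕ<n v) e)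
    }

  OnRun : ℕ → ℕ → Set
  OnRun j V = ((j < V × V ≤ q) ⊎ (q ≤ j × j < V × V ≤ q2))
            ⊎ ((q2 < V × V ≤ j × j < q3) ⊎ (q3 < V × V ≤ j × j < N ∸ 1))

  HopTo : ℕ → ℕ → Set
  HopTo b V = (b ≡ q × q < V × V ≤ q2) ⊎ (b ≡ q3 × q2 < V × V ≤ q3) ⊎ (b ≡ N ∸ 1 × q3 < V × V < N)

  HubUse : ℕ → ℕ → ℕ → Set
  HubUse V X Y = (Σ ℕ λ j → UnitStep j X Y × OnRun j V) ⊎ (Σ ℕ λ b → Pair 0 b X Y × HopTo b V)

  BladeUse : ℕ → ℕ → ℕ → Set
  BladeUse U X Y = UnitStep U X Y × U ≢ 0 × U ≢ q

  hubRoute-uses : ∀ V X Y → V < N → Consecutive 0 (hubRoute V) X Y → HubUse V X Y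
  hubRoute-uses V X Y V<N = go (V ≤? q) (V ≤? q2) (V ≤? q3)
    where
    go : ∀ d₁ d₂ d₃ → Consecutive 0 (hubRouteBy V d₁ d₂ d₃) X Y → HubUse V X Y
    go (yes V≤q) _ _ run with ups-steps 0 V X Y run
    ... | j , _ , j<V , st = inj₁ (j , st , inj₁ (inj₁ (j<V , V≤q)))
    go (no V≰q) (yes V≤q2) _ (inj₁ hop) = inj₂ (q , hop , inj₁ (refl , ≰⇒> V≰q , V≤q2))
    go (no V≰q) (yes V≤q2) _ (inj₂ run) with ups-steps q (V ∸ q) X Y run
    ... | j , q≤j , j<V , st =
      inj₁ (j , st , inj₁ (inj₂ (q≤j , subst (j <_) (m+[n∸m]≡n (<⇒≤ (≰⇒> V≰q))) j<V , V≤q2)))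
    go (no _) (no V≰q2) (yes V≤q3) (inj₁ hop) = inj₂ (q3 , hop , inj₂ (inj₁ (refl , ≰⇒> V≰q2 , V≤q3)))
    go (no _) (no V≰q2) (yes V≤q3) (inj₂ run)
      with dns-steps V (q3 ∸ V) X Y (subst (λ z → Consecutive z (dns V (q3 ∸ V)) X Y) (sym (m∸n+n≡m V≤q3)) run)
    ... | j , V≤j , j< , st = inj₁ (j , st , inj₂ (inj₁ (≰⇒> V≰q2 , V≤j , subst (j <_) (m∸n+n≡m V≤q3) j<)))
    go (no _) (no _) (no V≰q3) (inj₁ hop) = inj₂ (N ∸ 1 , hop , inj₂ (inj₂ (refl , ≰⇒> V≰q3 , V<N)))
    go (no _) (no _) (no V≰q3) (inj₂ run)
      with dns-steps V (N ∸ 1 ∸ V) X Y (subst (λ z → Consecutive z (dns V (N ∸ 1 ∸ V)) X Y) (sym (m∸n+n≡m (<⇒≤pred V<N))) run)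
    ... | j , V≤j , j< , st =
      inj₁ (j , st , inj₂ (inj₂ (≰⇒> V≰q3 , V≤j , subst (j <_) (m∸n+n≡m (<⇒≤pred V<N)) j<)))

  route-uses : ∀ U V X Y → U < V → V < N → T (friendAdj U V) → Consecutive U (route U V) X Y →
               (U ≡ 0 × HubUse V X Y) ⊎ (V ≡ suc U × BladeUse U X Y)
  route-uses U V X Y U<V V<N t = go (U ≟ 0) (V ≟ 0)
    where
    go : ∀ d₁ d₂ → Consecutive U (routeBy U V d₁ d₂) X Y →
         (U ≡ 0 × HubUse V X Y) ⊎ (V ≡ suc U × BladeUse U X Y)
    go (yes refl) _          c          = inj₁ (refl , hubRoute-uses V X Y V<N c)
    go (no _)     (yes refl) _          = ⊥-elim (n≮0 U<V)
    go (no U≢0)   (no V≢0)   (inj₁ pr)  =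
      inj₂ (V≡U+1 , subst (λ z → Pair U z X Y) V≡U+1 pr , U≢0 , blade-start≢q U V eq U<V)
      where
      eq : suc U / 2 ≡ suc V / 2
      eq = blade U V U≢0 V≢0 t
      V≡U+1 : V ≡ suc U
      V≡U+1 = blade-step U V eq U<V

  unitStep-unique : ∀ {J j X Y} → UnitStep J X Y → UnitStep j X Y → j ≡ J
  unitStep-unique (inj₁ (J≡X , _)) (inj₁ (j≡X , _)) = trans j≡X (sym J≡X)
  unitStep-unique (inj₂ (J≡Y , _)) (inj₂ (j≡Y , _)) = trans j≡Y (sym J≡Y)
  unitStep-unique {J} (inj₁ (J≡X , J+1≡Y)) (inj₂ (j≡Y , j+1≡X)) =
    ⊥-elim (n≢2+n J (trans J≡X (trans (sym j+1≡X) (cong suc (trans j≡Y (sym J+1≡Y))))))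
  unitStep-unique {J} (inj₂ (J≡Y , J+1≡X)) (inj₁ (j≡X , j+1≡Y)) =
    ⊥-elim (n≢2+n J (trans J≡Y (trans (sym j+1≡Y) (cong suc (trans j≡X (sym J+1≡X))))))

  -- ... and is never the hop of a hub route, since hops go from 0 to b ≥ 2.
  unitStep-not-hop : ∀ {J b V X Y} → UnitStep J X Y → Pair 0 b X Y → HopTo b V → ⊥
  unitStep-not-hop {J} {b} st hop to = <⇒≢ (hop≥2 to) (sym (hop≡1 st hop))
    where
    hop≡1 : UnitStep J _ _ → Pair 0 b _ _ → b ≡ 1
    hop≡1 (inj₁ (J≡X , J+1≡Y)) (inj₁ (0≡X , b≡Y)) = trans b≡Y (trans (sym J+1≡Y) (cong suc (trans J≡X (sym 0≡X))))
    hop≡1 (inj₂ (J≡Y , J+1≡X)) (inj₂ (0≡Y , b≡X)) = trans b≡X (trans (sym J+1≡X) (cong suc (trans J≡Y (sym 0≡Y))))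
    hop≡1 (inj₁ (_ , J+1≡Y))   (inj₂ (0≡Y , _))   = ⊥-elim (1+n≢0 (trans J+1≡Y (sym 0≡Y)))
    hop≡1 (inj₂ (_ , J+1≡X))   (inj₁ (0≡X , _))   = ⊥-elim (1+n≢0 (trans J+1≡X (sym 0≡X)))
    2≤q : 2 ≤ q
    2≤q = s≤s 0<r
    hop≥2 : ∀ {b V} → HopTo b V → 1 < b
    hop≥2 (inj₁ (refl , _))        = 2≤q
    hop≥2 (inj₂ (inj₁ (refl , _))) = ≤-trans 2≤q (<⇒≤ q<q3)
    hop≥2 (inj₂ (inj₂ (refl , _))) = ≤-trans 2≤q (<⇒≤ (<-trans q<q3 q3<N∸1))

  -- A budget for the H-edge {X , Y}: hub routes through it end in a window
  -- [L , L + len), and a blade through it starts at J and exists only if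
  -- extra ≥ 1.  By load-bound, at most len + extra ≤ q paths use {X , Y}.
  record Budget (X Y : ℕ) : Set where
    field
      L len J extra : ℕ
      within : len + extra ≤ q
      hubs   : ∀ V → HubUse V X Y → L ≤ V × V < L + len
      blades : ∀ U → BladeUse U X Y → U ≡ J × 1 ≤ extra

  -- Budgets of unit steps {J , J + 1}: only routes along the step and the
  -- blade at J can use it.
  unitBudget : ∀ {J X Y} → UnitStep J X Y → ∀ L len extra → len + extra ≤ q →
               (∀ V → OnRun J V → L ≤ V × V < L + len) → (J ≢ 0 → J ≢ q → 1 ≤ extra) →
               Budget X Y
  unitBudget {J} {X} {Y} st L len extra within window bladeOk =
    record { L = L ; len = len ; J = J ; extra = extra ; within = within ; hubs = hubs ; blades = blades }
    where
    hubs : ∀ V → HubUse V X Y → L ≤ V × V < L + len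
    hubs V (inj₁ (j , st′ , run)) = window V (subst (λ i → OnRun i V) (unitStep-unique st st′) run)
    hubs V (inj₂ (b , hop , to))  = ⊥-elim (unitStep-not-hop st hop to)
    blades : ∀ U → BladeUse U X Y → U ≡ J × 1 ≤ extra
    blades U (st′ , U≢0 , U≢q) =
      U≡J , bladeOk (λ J≡0 → U≢0 (trans U≡J J≡0)) (λ J≡q → U≢q (trans U≡J J≡q))
      where
      U≡J : U ≡ J
      U≡J = unitStep-unique st st′

  first-half : ∀ {J V} → J < q2 → OnRun J V → (J < V × V ≤ q) ⊎ (q ≤ J × J < V × V ≤ q2)
  first-half J<q2 (inj₁ run) = run
  first-half J<q2 (inj₂ (inj₁ (q2<V , V≤J , _))) = ⊥-elim (<-asym J<q2 (<-≤-trans q2<V V≤J))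
  first-half J<q2 (inj₂ (inj₂ (q3<V , V≤J , _))) =
    ⊥-elim (<-asym J<q2 (≤-<-trans q2≤q3 (<-≤-trans q3<V V≤J)))

  -- Routes along a unit step J < 2q end in (J , J + q] ...
  window-low : ∀ J → J < q2 → ∀ V → OnRun J V → suc J ≤ V × V < suc J + q
  window-low J J<q2 V run with first-half J<q2 run
  ... | inj₁ (J<V , V≤q)        = J<V , s≤s (≤-trans V≤q (m≤n+m q J))
  ... | inj₂ (q≤J , J<V , V≤q2) = J<V , s≤s (≤-trans V≤q2 (+-monoˡ-≤ q q≤J))

  -- ... and even in (J , J + q) when J ∉ {0 , q}, leaving room for a blade.
  window-mid : ∀ J → J < q2 → J ≢ 0 → J ≢ q → ∀ V → OnRun J V → suc J ≤ V × V < suc J + r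
  window-mid J J<q2 J≢0 J≢q V run with first-half J<q2 run
  ... | inj₁ (J<V , V≤q) =
    J<V , s≤s (≤-trans V≤q (+-monoˡ-≤ r (n≢0⇒n>0 J≢0)))
  ... | inj₂ (q≤J , J<V , V≤q2) =
    J<V , s≤s (≤-trans V≤q2 (subst (_≤ J + r) (sym (+-suc q r)) (+-monoˡ-≤ r (≤∧≢⇒< q≤J (J≢q ∘ sym)))))

  window-high-end : ∀ J V → q2 ≤ J → V ≤ J → V < (suc J ∸ r) + r
  window-high-end J V q2≤J V≤J =
    subst (V <_) (sym (m∸n+n≡m (≤-trans (n≤1+n r) (≤-trans q≤q2 (≤-trans q2≤J (n≤1+n J)))))) (s≤s V≤J)

  window-high : ∀ J → q2 ≤ J → ∀ V → OnRun J V → suc J ∸ r ≤ V × V < (suc J ∸ r) + r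
  window-high J q2≤J V run with run
  ... | inj₁ (inj₁ (J<V , V≤q))      = ⊥-elim (<-irrefl refl (<-≤-trans J<V (≤-trans V≤q (≤-trans q≤q2 q2≤J))))
  ... | inj₁ (inj₂ (_ , J<V , V≤q2)) = ⊥-elim (<-irrefl refl (<-≤-trans J<V (≤-trans V≤q2 q2≤J)))
  ... | inj₂ (inj₁ (q2<V , V≤J , J<q3)) =
    ≤-trans (∸-monoˡ-≤ r J<q3) (≤-trans (≤-reflexive q3∸r≡1+q2) q2<V) , window-high-end J V q2≤J V≤J
    where
    q3∸r≡1+q2 : q3 ∸ r ≡ suc q2
    q3∸r≡1+q2 = trans (cong (_∸ r) (+-suc q2 r)) (m+n∸n≡m (suc q2) r)
  ... | inj₂ (inj₂ (q3<V , V≤J , J<N∸1)) =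
    ≤-trans (∸-monoˡ-≤ r (subst (suc J ≤_) N∸1≡q3+r J<N∸1))
            (≤-trans (≤-reflexive (m+n∸n≡m q3 r)) (<⇒≤ q3<V)) , window-high-end J V q2≤J V≤J

  r+1≤q : r + 1 ≤ q
  r+1≤q = ≤-reflexive (+-comm r 1)

  -- Choice of window: J ≥ 2q (descending runs), J ∈ {0 , q} (the full window,
  -- no blade starts there), or any other J < 2q (q - 1 routes and one blade).
  unit-budget : ∀ J X Y → UnitStep J X Y → Budget X Y
  unit-budget J X Y st with J <? q2
  ... | no J≮q2 = unitBudget st (suc J ∸ r) r 1 r+1≤q (window-high J (≮⇒≥ J≮q2)) (λ _ _ → ≤-refl)
  ... | yes J<q2 with J ≟ 0 | J ≟ q
  ...   | yes J≡0 | _       = unitBudget st (suc J) q 0 (≤-reflexive (+-identityʳ q)) (window-low J J<q2)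
                                (λ J≢0 _ → ⊥-elim (J≢0 J≡0))
  ...   | no _    | yes J≡q = unitBudget st (suc J) q 0 (≤-reflexive (+-identityʳ q)) (window-low J J<q2)
                                (λ _ J≢q → ⊥-elim (J≢q J≡q))
  ...   | no J≢0  | no J≢q  = unitBudget st (suc J) r 1 r+1≤q (window-mid J J<q2 J≢0 J≢q) (λ _ _ → ≤-refl)

  -- Budgets of the other edges: only hub routes whose hop is {X , Y} use it,
  -- and these end within q consecutive vertices.
  hopBudget : ∀ {X Y} → (∀ j → ¬ UnitStep j X Y) → ∀ L →
              (∀ b V → Pair 0 b X Y → HopTo b V → L ≤ V × V < L + q) → Budget X Y
  hopBudget {X} {Y} notUnit L window = record
    { L = L ; len = q ; J = 0 ; extra = 0 ; within = ≤-reflexive (+-identityʳ q)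
    ; hubs   = λ { V (inj₁ (j , st , _))   → ⊥-elim (notUnit j st)
                 ; V (inj₂ (b , hop , to)) → window b V hop to }
    ; blades = λ { U (st , _) → ⊥-elim (notUnit U st) }
    }

  hopTarget : ∀ X Y → Σ ℕ λ W → ∀ b → Pair 0 b X Y → b ≡ W
  hopTarget X Y with X ≟ 0
  ... | yes X≡0 = Y , λ { b (inj₁ (_ , b≡Y)) → b≡Y ; b (inj₂ (0≡Y , b≡X)) → trans b≡X (trans X≡0 0≡Y) }
  ... | no X≢0  = X , λ { b (inj₁ (0≡X , _)) → ⊥-elim (X≢0 (sym 0≡X)) ; b (inj₂ (_ , b≡X)) → b≡X }

  hop-budget : ∀ X Y → (∀ j → ¬ UnitStep j X Y) → Budget X Y
  hop-budget X Y notUnit with hopTarget X Y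
  ... | W , toW with W ≟ q | W ≟ q3
  ...   | yes W≡q | _ = hopBudget notUnit (suc q) window
    where
    window : ∀ b V → Pair 0 b X Y → HopTo b V → suc q ≤ V × V < suc q + q
    window b V hop (inj₁ (_ , q<V , V≤q2))     = q<V , s≤s V≤q2
    window b V hop (inj₂ (inj₁ (b≡q3 , _)))    = ⊥-elim (<⇒≢ q<q3 (trans (sym W≡q) (trans (sym (toW b hop)) b≡q3)))
    window b V hop (inj₂ (inj₂ (b≡N∸1 , _)))   =
      ⊥-elim (<⇒≢ (<-trans q<q3 q3<N∸1) (trans (sym W≡q) (trans (sym (toW b hop)) b≡N∸1)))
  ...   | no W≢q | yes W≡q3 = hopBudget notUnit (suc q2) window
    where
    window : ∀ b V → Pair 0 b X Y → HopTo b V → suc q2 ≤ V × V < suc q2 + q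
    window b V hop (inj₁ (b≡q , _))              = ⊥-elim (W≢q (trans (sym (toW b hop)) b≡q))
    window b V hop (inj₂ (inj₁ (_ , q2<V , V≤q3))) = q2<V , s≤s V≤q3
    window b V hop (inj₂ (inj₂ (b≡N∸1 , _)))     =
      ⊥-elim (<⇒≢ q3<N∸1 (trans (sym W≡q3) (trans (sym (toW b hop)) b≡N∸1)))
  ...   | no W≢q | no W≢q3 = hopBudget notUnit q3 window
    where
    window : ∀ b V → Pair 0 b X Y → HopTo b V → q3 ≤ V × V < q3 + q
    window b V hop (inj₁ (b≡q , _))                = ⊥-elim (W≢q (trans (sym (toW b hop)) b≡q))
    window b V hop (inj₂ (inj₁ (b≡q3 , _)))        = ⊥-elim (W≢q3 (trans (sym (toW b hop)) b≡q3))
    window b V hop (inj₂ (inj₂ (_ , q3<V , V<N)))  = <⇒≤ q3<V , subst (V <_) N≡q3+q V<N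

  budget : ∀ X Y → Budget X Y
  budget X Y with Y ≟ suc X | X ≟ suc Y
  ... | yes Y≡X+1 | _         = unit-budget X X Y (inj₁ (refl , sym Y≡X+1))
  ... | no _      | yes X≡Y+1 = unit-budget Y X Y (inj₂ (refl , sym X≡Y+1))
  ... | no Y≢X+1  | no X≢Y+1  = hop-budget X Y notUnit
    where
    notUnit : ∀ j → ¬ UnitStep j X Y
    notUnit j (inj₁ (j≡X , j+1≡Y)) = Y≢X+1 (trans (sym j+1≡Y) (cong suc j≡X))
    notUnit j (inj₂ (j≡Y , j+1≡X)) = X≢Y+1 (trans (sym j+1≡X) (cong suc j≡Y))

  upper-bound : ∀ x y → EC-f embedding x y ≤ q
  upper-bound x y = ≤-trans (load-bound x y L len J (suc J) extra charged) within
    where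
    open Budget (budget (toℕ x) (toℕ y))
    open Congestion embedding
    charged : ∀ u v → toℕ u < toℕ v → (e : T (G u v)) → T (usesEdge (Embedding.P embedding u v e) x y) →
              (toℕ u ≡ 0 × L ≤ toℕ v × toℕ v < L + len) ⊎ (toℕ u ≡ J × toℕ v ≡ suc J × 1 ≤ extra)
    charged u v u<v e uses
      with route-uses (toℕ u) (toℕ v) (toℕ x) (toℕ y) u<v (toℕ<n v) e (walkOf-uses u _ v _ x y uses)
    ... | inj₁ (u≡0 , hub)     = inj₁ (u≡0 , hubs (toℕ v) hub)
    ... | inj₂ (v≡u+1 , blade) with blades (toℕ u) blade
    ...   | u≡J , 1≤extra = inj₂ (u≡J , trans v≡u+1 (cong suc u≡J) , 1≤extra)

  -- Lower bound: the hub has N - 1 = 4(q - 1) + 3 routes leaving it along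
  -- the 4 edges at its image.
  lower-bound : ∀ (E : Embedding G H) → Σ (Fin N) λ x → Σ (Fin N) λ y → T (H x y) × q ≤ EC-f E x y
  lower-bound = hub-congestion (λ v → tt) degree≤4 (subst (4 * r <_) (sym N∸1≡q3+r) (spare r))
    where
    spare : ∀ r → 4 * r < ((suc r + suc r) + suc r) + r
    spare r = subst (suc (4 * r) ≤_) (eq r) (m≤m+n (suc (4 * r)) 2)
      where
      eq : ∀ r → suc (4 * r) + 2 ≡ ((suc r + suc r) + suc r) + r
      eq = solve-∀

  congestion : ECis G H q
  congestion = (embedding , λ x y _ → upper-bound x y) , lower-bound

windmill-circulant : ∀ p → 0 < p → .{{_ : NonZero (2 * (2 * (2 * p)))}} →
  ECis (windmill (2 * (2 * p))) (circulant (2 * (2 * (2 * p))) (1 ∷ 2 * p ∷ [])) (2 * p)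
windmill-circulant (suc s) _ = Windmill.congestion s

-- For n = k + 3 the parameter is q = 2^(k+1) = 2 · 2^k.
theorem3 : Σ ℕ λ n₀ → ∀ n → n₀ ≤ n → ECis (WMn n) (Hn n) (2 ^ (n ∸ 2))
theorem3 = 3 , λ { (suc (suc (suc k))) (s≤s (s≤s (s≤s _))) →
                     windmill-circulant (2 ^ k) (m^n>0 2 k) {{m^n≢0 2 (3 + k)}} }
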